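{- For every class $\mathcal F$ of general frames over a finite alphabet $\mathrm{Al}$, $\mathrm{md}(\mathcal F)\le\mathrm{md}(\mathrm{Log}\,\mathcal F)$.
   Context: General frame $F=(X,(R_\Diamond)_{\Diamond\in\mathrm{Al}},\mathcal A)$ with $\mathcal A$ a Boolean subalgebra of $\mathcal P(X)$ closed under $R^{ -1}_\Diamond[\cdot]$; valuations take values in $\mathcal A$; $\mathrm{Log}\,\mathcal F$ is the set of formulas valid in all members of $\mathcal F$. Modal depth of frames: for $\mathcal V\subseteq\mathcal P(X)$, $a\equiv_{\mathcal V}b$ iff $\forall V\in\mathcal V(a\in V\Leftrightarrow b\in V)$; $\sim_{\mathcal V,0}=\equiv_{\mathcal V}$, $\mathcal V_0=X/{\sim_{\mathcal V,0}}$; for $d\ge1$, $\sim_{\mathcal V,d}$ is induced by $\mathcal V_{d-1}\cup\{R_\Diamond^{ -1}[V]:\Diamond\in\mathrm{Al},V\in\mathcal V_{d-1}\}$, $\mathcal V_d=X/{\sim_{\mathcal V,d}}$; $\mathcal V_\omega=\bigcup_d\mathcal V_d$; $\mathrm{md}(V)=\min\{d:V\in\mathcal V_d\}$; $\mathrm{md}(\mathcal V)=\sup_{V\in\mathcal V_\omega}\mathrm{md}(V)$; $\mathrm{md}(F)=\sup\{\mathrm{md}(\mathcal V):\mathcal V\subseteq\mathcal A$ finite$\}$; $\mathrm{md}(\mathcal F)=\sup_{F\in\mathcal F}\mathrm{md}(F)$. Modal depth of a logic: $\mathrm{md}(\varphi)$ maximal modal nesting; $\mathrm{md}_L(\varphi)=\min\{\mathrm{md}(\psi):\varphi\leftrightarrow\psi\in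 L\}$; $\mathrm{md}(L)=\sup_\varphi\mathrm{md}_L(\varphi)$. -}

module Defs where

open import Level using (Level)
open import Data.Nat using (ℕ; zero; suc; _⊔_; _≤_)
open import Data.Fin using (Fin)
open import Data.Bool using (Bool; true; false; not; _∨_)
open import Data.Product using (Σ; ∃-syntax; _×_; _,_; proj₁; proj₂)
open import Data.List using (List)
open import Data.List.Membership.Propositional using (_∈_)
open import Function.Bundles using (_⇔_)
open import Relation.Binary.PropositionalEquality using (_≡_)

data Formula (k : ℕ) : Set where
  var  : ℕ → Formula k
  ⊥f   : Formula k
  _⇒_  : Formula k → Formula k → Formula k
  ◇    : Fin k → Formula k → Formula k

infixr 5 _⇒_

module _ {k : ℕ} where
  ¬f_ : Formula k → Formula k
  ¬f φ = φ ⇒ ⊥f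

  _∧f_ : Formula k → Formula k → Formula k
  φ ∧f ψ = ¬f (φ ⇒ ¬f ψ)

  _⟺_ : Formula k → Formula k → Formula k
  φ ⟺ ψ = (φ ⇒ ψ) ∧f (ψ ⇒ φ)

  mdF : Formula k → ℕ
  mdF (var _)  = 0
  mdF ⊥f       = 0
  mdF (φ ⇒ ψ)  = mdF φ ⊔ mdF ψ
  mdF (◇ _ φ)  = suc (mdF φ)

-- P(X) is represented classically as X → Bool.
-- A : which subsets belong to the algebra 𝒜; 𝒜 is a Boolean
-- subalgebra (contains ∅, closed under complement and union,
-- extensional) closed under R_i⁻¹[·], where
--   R_i⁻¹[V] = { x | ∃ y. x R_i y ∧ y ∈ V }.

record Frame (k : ℕ) : Set₁ where
  field
    X       : Set
    R       : Fin k → X → X → Set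
    A       : (X → Bool) → Set
    A-ext   : ∀ {V W} → A V → (∀ x → V x ≡ W x) → A W
    A-∅     : A (λ _ → false)
    A-compl : ∀ {V} → A V → A (λ x → not (V x))
    A-∪     : ∀ {V W} → A V → A W → A (λ x → V x ∨ W x)
    pre     : Fin k → (V : X → Bool) → A V → X → Bool
    pre-spec : ∀ i V (AV : A V) x →
               (pre i V AV x ≡ true) ⇔ (∃[ y ] (R i x y × V y ≡ true))
    pre-A   : ∀ i V (AV : A V) → A (pre i V AV)

module _ {k : ℕ} (F : Frame k) where
  open Frame F

  ASet : Set
  ASet = Σ (X → Bool) A

  Valuation : Set
  Valuation = ℕ → ASet

  ⟦_⟧ : Formula k → Valuation → ASet
  ⟦ var p ⟧ v = v p
  ⟦ ⊥f ⟧ v = (λ _ → false) , A-∅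
  ⟦ φ ⇒ ψ ⟧ v with ⟦ φ ⟧ v | ⟦ ψ ⟧ v
  ... | (P , AP) | (Q , AQ) = (λ x → not (P x) ∨ Q x) , A-∪ (A-compl AP) AQ
  ⟦ ◇ i φ ⟧ v with ⟦ φ ⟧ v
  ... | (P , AP) = pre i P AP , pre-A i P AP

  Valid : Formula k → Set
  Valid φ = ∀ (v : Valuation) (x : X) → proj₁ (⟦ φ ⟧ v) x ≡ true

  -- For a finite 𝒱 ⊆ 𝒜 (a list), sim 𝒱 d is ∼_{𝒱,d}.
  -- Elements of 𝒱_{d} are the classes [c]_d = { y | sim 𝒱 d c y };
  -- membership of x in R_i⁻¹[[c]_d] is ∃ y. R i x y × sim 𝒱 d c y.
  sim : List ASet → ℕ → X → X → Set
  sim 𝒱 zero a b = ∀ {V} → V ∈ 𝒱 → proj₁ V a ≡ proj₁ V b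
  sim 𝒱 (suc d) a b =
    -- a,b agree on every V ∈ 𝒱_d  (i.e. on every class [c]_d)
    (∀ (c : X) → sim 𝒱 d c a ⇔ sim 𝒱 d c b) ×
    -- a,b agree on every R_i⁻¹[V], V ∈ 𝒱_d
    (∀ (i : Fin k) (c : X) →
       (∃[ y ] (R i a y × sim 𝒱 d c y)) ⇔ (∃[ y ] (R i b y × sim 𝒱 d c y)))

  -- the class [c]_d ∈ 𝒱_d already belongs to 𝒱_e (as a subset of X)
  ClassIn : List ASet → ℕ → X → ℕ → Set
  ClassIn 𝒱 d c e = ∃[ c' ] (∀ (y : X) → sim 𝒱 e c' y ⇔ sim 𝒱 d c y)

  -- md(𝒱) ≤ n : every V ∈ 𝒱_ω has md(V) ≤ n
  mdFam≤ : List ASet → ℕ → Set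
  mdFam≤ 𝒱 n = ∀ (d : ℕ) (c : X) → ∃[ e ] (e ≤ n × ClassIn 𝒱 d c e)

  mdFrame≤ : ℕ → Set
  mdFrame≤ n = ∀ (𝒱 : List ASet) → mdFam≤ 𝒱 n

module _ {ℓ : Level} {k : ℕ} (𝓕 : Frame k → Set ℓ) where

  Log : Formula k → Set (Level.suc Level.zero Level.⊔ ℓ)
  Log φ = ∀ (F : Frame k) → 𝓕 F → Valid F φ

  mdClass≤ : ℕ → Set (Level.suc Level.zero Level.⊔ ℓ)
  mdClass≤ n = ∀ (F : Frame k) → 𝓕 F → mdFrame≤ F n

  mdLogF≤ : Formula k → ℕ → Set (Level.suc Level.zero Level.⊔ ℓ)
  mdLogF≤ φ n = ∃[ ψ ] (mdF ψ ≤ n × Log (φ ⟺ ψ))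

  mdLog≤ : ℕ → Set (Level.suc Level.zero Level.⊔ ℓ)
  mdLog≤ n = ∀ (φ : Formula k) → mdLogF≤ φ n

{-# OPTIONS --safe #-}

-- Send the j-th variable to the j-th member of 𝒱.  Then ∼_{𝒱,d} is agreement on a finite
-- list Φ d of formulas of depth ≤ d, so every ∼_{𝒱,d}-class is defined by a conjunction of
-- signed members of Φ d.  Formulas of depth ≤ n are ∼_{𝒱,n}-invariant; hence if every
-- formula is equivalent on F to one of depth ≤ n, each ∼_{𝒱,d}-class is a union of
-- ∼_{𝒱,n}-classes, i.e. 𝒱_d = 𝒱_n for d ≥ n.
module Submission where

open import Defs
open import Level using (Level)
open import Data.Nat using (ℕ; zero; suc; _≤_; _<_; z≤n; s≤s; _≤′_; ≤′-refl; ≤′-step; _≤?_)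
open import Data.Nat.Properties using (≤⇒≤′; m⊔n≤o⇒m≤o; m⊔n≤o⇒n≤o; ≰⇒≥; ≤-refl)
open import Data.Bool using (Bool; true; false; not; _∨_)
open import Data.Bool.Properties using (⇔→≡)
open import Data.Product using (∃-syntax; _×_; _,_; proj₁; proj₂; map₂)
open import Data.List using (List; []; _∷_; _++_; length; allFin; applyUpTo; cartesianProductWith)
open import Data.List.Relation.Unary.Any using (here; there)
open import Data.List.Relation.Unary.All using (All; []; _∷_; tabulate; lookup)
open import Data.List.Relation.Unary.All.Properties using (++⁺; ++⁻ˡ; ++⁻ʳ)
open import Data.List.Membership.Propositional using (_∈_)
open import Data.List.Membership.Propositional.Properties
  using (∈-allFin; ∈-applyUpTo⁺; ∈-applyUpTo⁻; ∈-cartesianProductWith⁺; ∈-cartesianProductWith⁻)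
open import Function using (_∘_; flip)
open import Function.Bundles using (_⇔_; mk⇔; Equivalence)
open import Function.Construct.Identity using (⇔-id)
open import Function.Construct.Symmetry using (⇔-sym)
open import Function.Construct.Composition using (_⇔-∘_)
open import Relation.Binary.PropositionalEquality 
  using (_≡_; refl; sym; trans; cong₂; subst; module ≡-Reasoning)
open import Relation.Nullary using (yes; no)

open Equivalence using (to; from)

module _ {k : ℕ} where

  ⊤f : Formula k
  ⊤f = ¬f ⊥f

  literal : Bool → Formula k → Formula k
  literal true  φ = φ
  literal false φ = ¬f φ

  signedConjunct : Formula k → Bool → Formula k → Formula k
  signedConjunct τ b χ = literal b τ ∧f χ

  signedConjunctions : List (Formula k) → List (Formula k)
  signedConjunctions []      = ⊤f ∷ []
  signedConjunctions (τ ∷ L) =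
    cartesianProductWith (signedConjunct τ) (true ∷ false ∷ []) (signedConjunctions L)

module Semantics {k : ℕ} (F : Frame k) (v : Valuation F) where
  open Frame F

  eval : Formula k → X → Bool
  eval φ = proj₁ (⟦_⟧ F φ v)

  Invariant : (X → X → Set) → Formula k → Set
  Invariant _≈_ φ = ∀ {a b} → a ≈ b → eval φ a ≡ eval φ b

  Agree : List (Formula k) → X → X → Set
  Agree L a b = All (λ τ → eval τ a ≡ eval τ b) L

  module _ {_≈_ : X → X → Set} where

    ⊥f-invariant : Invariant _≈_ ⊥f
    ⊥f-invariant _ = refl

    ⇒-invariant : ∀ φ ψ → Invariant _≈_ φ → Invariant _≈_ ψ → Invariant _≈_ (φ ⇒ ψ)
    ⇒-invariant φ ψ φ-inv ψ-inv a≈b = cong₂ (λ p q → not p ∨ q) (φ-inv a≈b) (ψ-inv a≈b)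

    ¬f-invariant : ∀ φ → Invariant _≈_ φ → Invariant _≈_ (¬f φ)
    ¬f-invariant φ φ-inv = ⇒-invariant φ ⊥f φ-inv ⊥f-invariant

    ∧f-invariant : ∀ φ ψ → Invariant _≈_ φ → Invariant _≈_ ψ → Invariant _≈_ (φ ∧f ψ)
    ∧f-invariant φ ψ φ-inv ψ-inv =
      ¬f-invariant (φ ⇒ ¬f ψ) (⇒-invariant φ (¬f ψ) φ-inv (¬f-invariant ψ ψ-inv))

    literal-invariant : ∀ b φ → Invariant _≈_ φ → Invariant _≈_ (literal b φ)
    literal-invariant true  φ φ-inv = φ-inv
    literal-invariant false φ φ-inv = ¬f-invariant φ φ-inv

  ⇒-true : ∀ φ ψ x → eval (φ ⇒ ψ) x ≡ true → eval φ x ≡ true → eval ψ x ≡ true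
  ⇒-true φ ψ x = modusPonens (eval φ x)
    where
    modusPonens : ∀ p → not p ∨ eval ψ x ≡ true → p ≡ true → eval ψ x ≡ true
    modusPonens true ψ-true refl = ψ-true

  ∧f-true : ∀ φ ψ x → eval (φ ∧f ψ) x ≡ true ⇔ (eval φ x ≡ true × eval ψ x ≡ true)
  ∧f-true φ ψ x = conjunction (eval φ x) (eval ψ x)
    where
    conjunction : ∀ p q → not (not p ∨ (not q ∨ false)) ∨ false ≡ true ⇔ (p ≡ true × q ≡ true)
    conjunction true  true  = mk⇔ (λ _ → refl , refl) (λ _ → refl)
    conjunction true  false = mk⇔ (λ ()) (λ { (_ , ()) })
    conjunction false q     = mk⇔ (λ ()) (λ { (() , _) })

  ⟺-true⇒≡ : ∀ φ ψ x → eval (φ ⟺ ψ) x ≡ true → eval φ x ≡ eval ψ x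
  ⟺-true⇒≡ φ ψ x φ⟺ψ = ⇔→≡ (mk⇔ (⇒-true φ ψ x φ⇒ψ) (⇒-true ψ φ x ψ⇒φ))
    where
    φ⇒ψ = proj₁ (to (∧f-true (φ ⇒ ψ) (ψ ⇒ φ) x) φ⟺ψ)
    ψ⇒φ = proj₂ (to (∧f-true (φ ⇒ ψ) (ψ ⇒ φ) x) φ⟺ψ)

  literal-true : ∀ b φ x → eval (literal b φ) x ≡ true ⇔ eval φ x ≡ b
  literal-true true  φ x = ⇔-id _
  literal-true false φ x = negation (eval φ x)
    where
    negation : ∀ p → not p ∨ false ≡ true ⇔ p ≡ false
    negation true  = mk⇔ (λ ()) (λ ())
    negation false = mk⇔ (λ _ → refl) (λ _ → refl)

  ◇-defines : ∀ i χ {P : X → Set} → (∀ z → eval χ z ≡ true ⇔ P z) →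
              ∀ x → eval (◇ i χ) x ≡ true ⇔ (∃[ y ] (R i x y × P y))
  ◇-defines i χ χ-def x =
    mk⇔ (map₂ (map₂ (to (χ-def _))) ∘ to ◇-spec) (from ◇-spec ∘ map₂ (map₂ (from (χ-def _))))
    where ◇-spec = pre-spec i _ (proj₂ (⟦_⟧ F χ v)) x

  signedConjunction-invariant : ∀ L {χ} → χ ∈ signedConjunctions L → Invariant (Agree L) χ
  signedConjunction-invariant [] (here refl) _ = refl
  signedConjunction-invariant (τ ∷ L) χ∈
    with b , χ′ , _ , χ′∈ , refl
           ← ∈-cartesianProductWith⁻ (signedConjunct τ) (true ∷ false ∷ []) (signedConjunctions L) χ∈ =
    ∧f-invariant {Agree (τ ∷ L)} (literal b τ) χ′
      (literal-invariant {Agree (τ ∷ L)} b τ λ { (τ-agrees ∷ _) → τ-agrees })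
      λ { (_ ∷ L-agrees) → signedConjunction-invariant L χ′∈ L-agrees }

  signedConjunction-defines : ∀ L c →
    ∃[ χ ] (χ ∈ signedConjunctions L × ∀ z → eval χ z ≡ true ⇔ Agree L c z)
  signedConjunction-defines []      c = ⊤f , here refl , λ _ → mk⇔ (λ _ → []) (λ _ → refl)
  signedConjunction-defines (τ ∷ L) c
    with χ , χ∈ , χ-def ← signedConjunction-defines L c =
    signedConjunct τ b χ , ∈-cartesianProductWith⁺ (signedConjunct τ) (bool∈ b) χ∈ ,
    λ z → mk⇔ (agrees z) (satisfies z)
    where
    b = eval τ c
    bool∈ : ∀ b → b ∈ true ∷ false ∷ []
    bool∈ true  = here refl
    bool∈ false = there (here refl)
    agrees : ∀ z → eval (literal b τ ∧f χ) z ≡ true → Agree (τ ∷ L) c z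
    agrees z holds with lit , χ-holds ← to (∧f-true (literal b τ) χ z) holds =
      sym (to (literal-true b τ z) lit) ∷ to (χ-def z) χ-holds
    satisfies : ∀ z → Agree (τ ∷ L) c z → eval (literal b τ ∧f χ) z ≡ true
    satisfies z (τ-agrees ∷ L-agrees) =
      from (∧f-true (literal b τ) χ z)
           (from (literal-true b τ z) (sym τ-agrees) , from (χ-def z) L-agrees)

module _ {k : ℕ} (F : Frame k) where
  open Frame F

  listValuation : List (ASet F) → Valuation F
  listValuation []       _       = (λ _ → false) , A-∅
  listValuation (V ∷ 𝒱) zero    = V
  listValuation (V ∷ 𝒱) (suc j) = listValuation 𝒱 j

  listValuation-cong : ∀ 𝒱 {a b} → (∀ {V} → V ∈ 𝒱 → proj₁ V a ≡ proj₁ V b) →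
                       ∀ j → proj₁ (listValuation 𝒱 j) a ≡ proj₁ (listValuation 𝒱 j) b
  listValuation-cong []      _      _       = refl
  listValuation-cong (V ∷ 𝒱) agrees zero    = agrees (here refl)
  listValuation-cong (V ∷ 𝒱) agrees (suc j) = listValuation-cong 𝒱 (agrees ∘ there) j

  listValuation-index : ∀ 𝒱 {V} → V ∈ 𝒱 → ∃[ j ] (j < length 𝒱 × listValuation 𝒱 j ≡ V)
  listValuation-index (V ∷ 𝒱) (here refl) = zero , s≤s z≤n , refl
  listValuation-index (W ∷ 𝒱) (there V∈)
    with j , j< , eq ← listValuation-index 𝒱 V∈ = suc j , s≤s j< , eq

module Depth {k : ℕ} (F : Frame k) (𝒱 : List (ASet F)) where
  open Frame F
  open Semantics F (listValuation F 𝒱)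

  _∼[_]_ : X → ℕ → X → Set
  a ∼[ d ] b = sim F 𝒱 d a b

  sim-refl : ∀ d {a} → a ∼[ d ] a
  sim-refl zero    _ = refl
  sim-refl (suc d)   = (λ _ → ⇔-id _) , (λ _ _ → ⇔-id _)

  sim-sym : ∀ d {a b} → a ∼[ d ] b → b ∼[ d ] a
  sim-sym zero    a∼b V∈ = sym (a∼b V∈)
  sim-sym (suc d) (classes , reach) = ⇔-sym ∘ classes , λ i → ⇔-sym ∘ reach i

  sim-trans : ∀ d {a b c} → a ∼[ d ] b → b ∼[ d ] c → a ∼[ d ] c
  sim-trans zero    a∼b b∼c V∈ = trans (a∼b V∈) (b∼c V∈)
  sim-trans (suc d) (classes₁ , reach₁) (classes₂ , reach₂) =
    (λ c → classes₂ c ⇔-∘ classes₁ c) , (λ i c → reach₂ i c ⇔-∘ reach₁ i c)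

  sim-suc⇒sim : ∀ d {a b} → a ∼[ suc d ] b → a ∼[ d ] b
  sim-suc⇒sim d (classes , _) = to (classes _) (sim-refl d)

  sim-antitone′ : ∀ {m d} → m ≤′ d → ∀ {a b} → a ∼[ d ] b → a ∼[ m ] b
  sim-antitone′ ≤′-refl          = λ a∼b → a∼b
  sim-antitone′ (≤′-step {d} m≤d) = sim-antitone′ m≤d ∘ sim-suc⇒sim d

  sim-antitone : ∀ {m d} → m ≤ d → ∀ {a b} → a ∼[ d ] b → a ∼[ m ] b
  sim-antitone = sim-antitone′ ∘ ≤⇒≤′

  var-invariant : ∀ j → Invariant (_∼[ 0 ]_) (var j)
  var-invariant j a∼b = listValuation-cong F 𝒱 a∼b j

  ◇-invariant : ∀ d i φ → Invariant (_∼[ d ]_) φ → Invariant (_∼[ suc d ]_) (◇ i φ)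
  ◇-invariant d i φ φ-inv {a} {b} (_ , reach) =
    ⇔→≡ (mk⇔ (transfer (λ c → to (reach i c))) (transfer (λ c → from (reach i c))))
    where
    transfer : ∀ {x x′} → (∀ c → ∃[ y ] (R i x y × c ∼[ d ] y) → ∃[ y ] (R i x′ y × c ∼[ d ] y)) →
               eval (◇ i φ) x ≡ true → eval (◇ i φ) x′ ≡ true
    transfer {x} {x′} reach→ ◇φ
      with y , xRy , φy ← to (◇-defines i φ (λ _ → ⇔-id _) x) ◇φ
      with y′ , x′Ry′ , y∼y′ ← reach→ y (y , xRy , sim-refl d) =
      from (◇-defines i φ (λ _ → ⇔-id _) x′) (y′ , x′Ry′ , trans (sym (φ-inv y∼y′)) φy)

  depth-invariant : ∀ {n} φ → mdF φ ≤ n → Invariant (_∼[ n ]_) φ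
  depth-invariant (var j) _ = var-invariant j ∘ sim-antitone z≤n
  depth-invariant {n} ⊥f _ = ⊥f-invariant {_∼[ n ]_}
  depth-invariant (φ ⇒ ψ) md =
    ⇒-invariant φ ψ (depth-invariant φ (m⊔n≤o⇒m≤o (mdF φ) (mdF ψ) md))
                    (depth-invariant ψ (m⊔n≤o⇒n≤o (mdF φ) (mdF ψ) md))
  depth-invariant {suc n} (◇ i φ) (s≤s md) = ◇-invariant n i φ (depth-invariant φ md)

  Φ : ℕ → List (Formula k)
  Φ zero    = applyUpTo var (length 𝒱)
  Φ (suc d) = Φ d ++ cartesianProductWith ◇ (allFin k) (signedConjunctions (Φ d))

  class-definable : ∀ d c →
    ∃[ χ ] (χ ∈ signedConjunctions (Φ d) × (∀ z → eval χ z ≡ true ⇔ c ∼[ d ] z))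
  sim⇔agree : ∀ d {a b} → a ∼[ d ] b ⇔ Agree (Φ d) a b

  class-definable d c with χ , χ∈ , χ-def ← signedConjunction-defines (Φ d) c =
    χ , χ∈ , λ z → ⇔-sym (sim⇔agree d) ⇔-∘ χ-def z

  sim⇔agree zero = mk⇔ sim⇒agree agree⇒sim
    where
    sim⇒agree : ∀ {a b} → a ∼[ 0 ] b → Agree (Φ 0) a b
    sim⇒agree {a} {b} a∼b = tabulate var-agrees
      where
      var-agrees : ∀ {τ} → τ ∈ Φ 0 → eval τ a ≡ eval τ b
      var-agrees τ∈ with j , _ , refl ← ∈-applyUpTo⁻ var τ∈ = var-invariant j a∼b
    agree⇒sim : ∀ {a b} → Agree (Φ 0) a b → a ∼[ 0 ] b
    agree⇒sim {a} {b} agrees V∈ with j , j< , V≡ ← listValuation-index F 𝒱 V∈ =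
      subst (λ V → proj₁ V a ≡ proj₁ V b) V≡ (lookup agrees (∈-applyUpTo⁺ var j<))
  sim⇔agree (suc d) {a} {b} = mk⇔ sim⇒agree agree⇒sim
    where
    sim⇒agree : a ∼[ suc d ] b → Agree (Φ (suc d)) a b
    sim⇒agree a∼b = ++⁺ (to (sim⇔agree d) (sim-suc⇒sim d a∼b)) (tabulate ◇-agrees)
      where
      ◇-agrees : ∀ {τ} → τ ∈ cartesianProductWith ◇ (allFin k) (signedConjunctions (Φ d)) →
                 eval τ a ≡ eval τ b
      ◇-agrees τ∈ with i , χ , _ , χ∈ , refl ← ∈-cartesianProductWith⁻ ◇ (allFin k) _ τ∈ =
        ◇-invariant d i χ (signedConjunction-invariant (Φ d) χ∈ ∘ to (sim⇔agree d)) a∼b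
    agree⇒sim : Agree (Φ (suc d)) a b → a ∼[ suc d ] b
    agree⇒sim agrees = classes , reach
      where
      a∼b : a ∼[ d ] b
      a∼b = from (sim⇔agree d) (++⁻ˡ (Φ d) agrees)
      classes : ∀ c → c ∼[ d ] a ⇔ c ∼[ d ] b
      classes c = mk⇔ (flip (sim-trans d) a∼b) (flip (sim-trans d) (sim-sym d a∼b))
      reach : ∀ i c → (∃[ y ] (R i a y × c ∼[ d ] y)) ⇔ (∃[ y ] (R i b y × c ∼[ d ] y))
      reach i c with χ , χ∈ , χ-def ← class-definable d c =
        ◇-defines i χ χ-def b
          ⇔-∘ (mk⇔ (trans (sym ◇χ-agrees)) (trans ◇χ-agrees) ⇔-∘ ⇔-sym (◇-defines i χ χ-def a))
        where
        ◇χ-agrees : eval (◇ i χ) a ≡ eval (◇ i χ) b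
        ◇χ-agrees = lookup (++⁻ʳ (Φ d) agrees) (∈-cartesianProductWith⁺ ◇ (∈-allFin i) χ∈)

DepthBounded : ∀ {k} → Frame k → ℕ → Set
DepthBounded {k} F n = ∀ (φ : Formula k) → ∃[ ψ ] (mdF ψ ≤ n × Valid F (φ ⟺ ψ))

module _ {k : ℕ} {F : Frame k} {n : ℕ} (bounded : DepthBounded F n) (𝒱 : List (ASet F)) where
  open Depth F 𝒱
  open Semantics F (listValuation F 𝒱)
  open ≡-Reasoning

  sim-stable : ∀ {d} → n ≤ d → ∀ {c y} → c ∼[ n ] y ⇔ c ∼[ d ] y
  sim-stable {d} n≤d {c} {y}
    with χ , _ , χ-def ← class-definable d c
    with ψ , mdψ≤n , χ⟺ψ ← bounded χ =
    mk⇔ (λ c∼y → to (χ-def y) (χ-holds-at c∼y)) (sim-antitone n≤d)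
    where
    χ≡ψ : ∀ x → eval χ x ≡ eval ψ x
    χ≡ψ x = ⟺-true⇒≡ χ ψ x (χ⟺ψ (listValuation F 𝒱) x)
    χ-holds-at : c ∼[ n ] y → eval χ y ≡ true
    χ-holds-at c∼y = begin
      eval χ y ≡⟨ χ≡ψ y ⟩
      eval ψ y ≡⟨ depth-invariant ψ mdψ≤n (sim-sym n c∼y) ⟩
      eval ψ c ≡⟨ χ≡ψ c ⟨
      eval χ c ≡⟨ from (χ-def c) (sim-refl d) ⟩
      true     ∎

depthBounded⇒mdFrame≤ : ∀ {k} (F : Frame k) n → DepthBounded F n → mdFrame≤ F n
depthBounded⇒mdFrame≤ F n bounded 𝒱 d c with d ≤? n
... | yes d≤n = d , d≤n , c , λ _ → ⇔-id _
... | no  d≰n = n , ≤-refl , c , λ _ → sim-stable bounded 𝒱 (≰⇒≥ d≰n)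

proposition6p12 : ∀ {ℓ : Level} (k : ℕ) (𝓕 : Frame k → Set ℓ) (n : ℕ) →
    mdLog≤ 𝓕 n → mdClass≤ 𝓕 n
proposition6p12 k 𝓕 n mdLog≤n F F∈𝓕 =
  depthBounded⇒mdFrame≤ F n (λ φ → map₂ (map₂ (λ φ⟺ψ∈Log → φ⟺ψ∈Log F F∈𝓕)) (mdLog≤n φ))
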